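{- For integers $1\le k\le n$ and every positive integer $t$: (1) $H_{n+t,k+t}=F_{1+t}H_{n,k}+F_tH_{n-1,k-1}$; (2) $H_{n+t,k}=F_{1+t}H_{n,k}+F_tH_{n-1,k}$.
   Context: $F_n$ denotes the Fibonacci numbers ($F_0=0$, $F_1=1$, $F_{n}=F_{n-1}+F_{n-2}$), extended to negative indices by $F_{ -n}=(-1)^{n-1}F_n$. For integers $r,k$, $H_{r,k}=F_{k+1}F_{r-k+2}-F_kF_{r-k+1}=F_{k-1}F_{r-k+2}+F_kF_{r-k}$. -}

module Defs where

open import Data.Nat using (ℕ; zero; suc)
open import Data.Integer using (ℤ; +_; -[1+_]; _+_; _-_; _*_; -_)

fib : ℕ → ℕ
fib zero = zero
fib (suc zero) = suc zero
fib (suc (suc n)) = fib (suc n) Data.Nat.+ fib n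

sgn : ℕ → ℤ
sgn zero = + 1
sgn (suc m) = - sgn m

-- Fibonacci numbers on ℤ: F_{-n} = (-1)^(n-1) F_n
F : ℤ → ℤ
F (+ n) = + fib n
F -[1+ m ] = sgn m * + fib (suc m)

H : ℤ → ℤ → ℤ
H r k = F (k + + 1) * F (r - k + + 2) - F k * F (r - k + + 1)

-- H r k = G k (r - k) with G a b = F(a+1) F(b+2) - F a F(b+1), and G is
-- linear in each of the two sequences F(a + ·) and F(b + ·).  Shifting n and k
-- together by t shifts only a, shifting n alone shifts only b, and each shift
-- is expanded by the addition formula F(a+1+t) = F(t+1) F(a+1) + F(t) F(a),
-- which holds for every integer sequence satisfying the Fibonacci recurrence.
module Submission where

open import Defs
open import Data.Nat using (ℕ; zero; suc)
import Data.Nat.Properties as ℕ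
open import Data.Integer using (ℤ; +_; -[1+_]; _+_; _-_; _*_; _≤_; -_)
open import Data.Integer.Properties using (+-identityʳ)
open import Data.Integer.Tactic.RingSolver using (solve-∀)
open import Data.Product using (_×_; _,_)
open import Relation.Binary.PropositionalEquality
open ≡-Reasoning

IsFibonacciLike : (ℤ → ℤ) → Set
IsFibonacciLike f = ∀ m → f (m + + 2) ≡ f (m + + 1) + f m

F-isFibonacciLike : IsFibonacciLike F
F-isFibonacciLike (+ n) rewrite ℕ.+-comm n 2 | ℕ.+-comm n 1 = refl
F-isFibonacciLike -[1+ zero ] = refl
F-isFibonacciLike -[1+ suc zero ] = refl
F-isFibonacciLike -[1+ suc (suc j) ] = sgn-step (sgn j) (+ fib (suc j)) (+ fib (suc (suc j)))
  where
  sgn-step : ∀ s x y → s * x ≡ - s * y + - (- s) * (y + x)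
  sgn-step = solve-∀

fibonacciLike-addition : ∀ {f} → IsFibonacciLike f →
  ∀ a t → f (a + + 1 + + t) ≡ F (+ 1 + + t) * f (a + + 1) + F (+ t) * f a
fibonacciLike-addition {f} _ a zero = begin
  f (a + + 1 + + 0)           ≡⟨ cong f (+-identityʳ (a + + 1)) ⟩
  f (a + + 1)                 ≡⟨ identity (f (a + + 1)) (f a) ⟩
  + 1 * f (a + + 1) + + 0 * f a ∎
  where
  identity : ∀ x y → x ≡ + 1 * x + + 0 * y
  identity = solve-∀
fibonacciLike-addition {f} rec a (suc zero) = begin
  f (a + + 1 + + 1)           ≡⟨ cong f (reindex a) ⟩
  f (a + + 2)                 ≡⟨ rec a ⟩
  f (a + + 1) + f a           ≡⟨ identity (f (a + + 1)) (f a) ⟩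
  + 1 * f (a + + 1) + + 1 * f a ∎
  where
  reindex : ∀ a → a + + 1 + + 1 ≡ a + + 2
  reindex = solve-∀
  identity : ∀ x y → x + y ≡ + 1 * x + + 1 * y
  identity = solve-∀
fibonacciLike-addition {f} rec a (suc (suc t)) = begin
  f (a + + 1 + + suc (suc t))
    ≡⟨ cong f (reindex₂ a (+ t)) ⟩
  f (a + + 1 + + t + + 2)
    ≡⟨ rec (a + + 1 + + t) ⟩
  f (a + + 1 + + t + + 1) + f (a + + 1 + + t)
    ≡⟨ cong₂ _+_ (trans (cong f (reindex₁ a (+ t))) (fibonacciLike-addition rec a (suc t)))
                 (fibonacciLike-addition rec a t) ⟩
  (F (+ 1 + + suc t) * f (a + + 1) + F (+ suc t) * f a) + (F (+ 1 + + t) * f (a + + 1) + F (+ t) * f a)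
    ≡⟨ collect (+ fib (suc (suc t))) (+ fib (suc t)) (+ fib t) (f (a + + 1)) (f a) ⟩
  F (+ 1 + + suc (suc t)) * f (a + + 1) + F (+ suc (suc t)) * f a ∎
  where
  reindex₂ : ∀ a t → a + + 1 + (+ 2 + t) ≡ a + + 1 + t + + 2
  reindex₂ = solve-∀
  reindex₁ : ∀ a t → a + + 1 + t + + 1 ≡ a + + 1 + (+ 1 + t)
  reindex₁ = solve-∀
  collect : ∀ p q r x y → (p * x + q * y) + (q * x + r * y) ≡ (p + q) * x + (q + r) * y
  collect = solve-∀

F-addition : ∀ a t → F (a + + 1 + + t) ≡ F (+ 1 + + t) * F (a + + 1) + F (+ t) * F a
F-addition = fibonacciLike-addition F-isFibonacciLike

G : ℤ → ℤ → ℤ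
G a b = F (a + + 1) * F (b + + 2) - F a * F (b + + 1)

H≡G : ∀ r k → H r k ≡ G k (r - k)
H≡G r k = refl

G-shiftˡ : ∀ a b t → G (a + + 1 + + t) b ≡ F (+ 1 + + t) * G (a + + 1) b + F (+ t) * G a b
G-shiftˡ a b t = begin
  F (a + + 1 + + t + + 1) * F (b + + 2) - F (a + + 1 + + t) * F (b + + 1)
    ≡⟨ cong₂ (λ x y → x * F (b + + 2) - y * F (b + + 1))
             (trans (cong F (reindex a (+ t))) (F-addition (a + + 1) t))
             (F-addition a t) ⟩
  (A * F (a + + 1 + + 1) + B * F (a + + 1)) * F (b + + 2) - (A * F (a + + 1) + B * F a) * F (b + + 1)
    ≡⟨ distribute A B _ _ _ _ _ _ ⟩
  A * G (a + + 1) b + B * G a b ∎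
  where
  A = F (+ 1 + + t)
  B = F (+ t)
  reindex : ∀ a t → a + + 1 + t + + 1 ≡ a + + 1 + + 1 + t
  reindex = solve-∀
  distribute : ∀ A B x₁ x₀ y₁ y₀ p q →
    (A * x₁ + B * x₀) * p - (A * y₁ + B * y₀) * q ≡ A * (x₁ * p - y₁ * q) + B * (x₀ * p - y₀ * q)
  distribute = solve-∀

G-shiftʳ : ∀ a b t → G a (b + + 1 + + t) ≡ F (+ 1 + + t) * G a (b + + 1) + F (+ t) * G a b
G-shiftʳ a b t = begin
  F (a + + 1) * F (b + + 1 + + t + + 2) - F a * F (b + + 1 + + t + + 1)
    ≡⟨ cong₂ (λ x y → F (a + + 1) * x - F a * y)
             (trans (cong F (reindex₂ b (+ t))) (F-addition (b + + 2) t))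
             (trans (cong F (reindex₁ b (+ t))) (F-addition (b + + 1) t)) ⟩
  F (a + + 1) * (A * F (b + + 2 + + 1) + B * F (b + + 2)) - F a * (A * F (b + + 1 + + 1) + B * F (b + + 1))
    ≡⟨ cong (λ x → F (a + + 1) * (A * F x + B * F (b + + 2)) - F a * (A * F (b + + 1 + + 1) + B * F (b + + 1)))
            (swap b) ⟩
  F (a + + 1) * (A * F (b + + 1 + + 2) + B * F (b + + 2)) - F a * (A * F (b + + 1 + + 1) + B * F (b + + 1))
    ≡⟨ distribute A B (F (b + + 1 + + 2)) (F (b + + 1 + + 1)) (F (b + + 2)) (F (b + + 1)) (F (a + + 1)) (F a) ⟩
  A * G a (b + + 1) + B * G a b ∎
  where
  A = F (+ 1 + + t)
  B = F (+ t)
  reindex₂ : ∀ b t → b + + 1 + t + + 2 ≡ b + + 2 + + 1 + t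
  reindex₂ = solve-∀
  reindex₁ : ∀ b t → b + + 1 + t + + 1 ≡ b + + 1 + + 1 + t
  reindex₁ = solve-∀
  swap : ∀ b → b + + 2 + + 1 ≡ b + + 1 + + 2
  swap = solve-∀
  distribute : ∀ A B x₁ y₁ x₀ y₀ p q →
    p * (A * x₁ + B * x₀) - q * (A * y₁ + B * y₀) ≡ A * (p * x₁ - q * y₁) + B * (p * x₀ - q * y₀)
  distribute = solve-∀

lemma2p9 : (n k : ℤ) (t : ℕ) → + 1 ≤ k → k ≤ n → + 1 ≤ + t →
    (H (n + + t) (k + + t) ≡ F (+ 1 + + t) * H n k + F (+ t) * H (n - + 1) (k - + 1))
    × (H (n + + t) k ≡ F (+ 1 + + t) * H n k + F (+ t) * H (n - + 1) k)
lemma2p9 n k t _ _ _ = shift-both , shift-first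
  where
  A = F (+ 1 + + t)
  B = F (+ t)
  pred-suc : ∀ x → x ≡ x - + 1 + + 1
  pred-suc = solve-∀
  shift-cancels : ∀ n k t → n + t - (k + t) ≡ n - k
  shift-cancels = solve-∀
  pred-diff : ∀ n k → n - + 1 - (k - + 1) ≡ n - k
  pred-diff = solve-∀
  pred-suc-shift : ∀ k t → k + t ≡ k - + 1 + + 1 + t
  pred-suc-shift = solve-∀
  diff-pred : ∀ n k → n - + 1 - k ≡ n - k - + 1
  diff-pred = solve-∀
  diff-shift : ∀ n k t → n + t - k ≡ n - k - + 1 + + 1 + t
  diff-shift = solve-∀

  shift-both : H (n + + t) (k + + t) ≡ A * H n k + B * H (n - + 1) (k - + 1)
  shift-both = begin
    H (n + + t) (k + + t)                       ≡⟨ H≡G (n + + t) (k + + t) ⟩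
    G (k + + t) (n + + t - (k + + t))           ≡⟨ cong₂ G (pred-suc-shift k (+ t)) (shift-cancels n k (+ t)) ⟩
    G (k - + 1 + + 1 + + t) (n - k)             ≡⟨ G-shiftˡ (k - + 1) (n - k) t ⟩
    A * G (k - + 1 + + 1) (n - k) + B * G (k - + 1) (n - k)
      ≡⟨ sym (cong₂ (λ a b → A * G a (n - k) + B * G (k - + 1) b) (pred-suc k) (pred-diff n k)) ⟩
    A * H n k + B * H (n - + 1) (k - + 1)       ∎

  shift-first : H (n + + t) k ≡ A * H n k + B * H (n - + 1) k
  shift-first = begin
    H (n + + t) k                               ≡⟨ H≡G (n + + t) k ⟩
    G k (n + + t - k)                           ≡⟨ cong (G k) (diff-shift n k (+ t)) ⟩
    G k (n - k - + 1 + + 1 + + t)               ≡⟨ G-shiftʳ k (n - k - + 1) t ⟩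
    A * G k (n - k - + 1 + + 1) + B * G k (n - k - + 1)
      ≡⟨ sym (cong₂ (λ a b → A * G k a + B * G k b) (pred-suc (n - k)) (diff-pred n k)) ⟩
    A * H n k + B * H (n - + 1) k               ∎
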